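{- Let $(H,\omega)$ be an edge-weighted graph with positive integer weights, let $\tau$ be a non-negative integer, and let $(G,\mathcal S)=(G(H,\omega),\mathcal S(H,\omega))$. If $H$ admits a $\tau$-balancing order, then there is a path mapping $(P,f)$ of $(G,\mathcal S)$ of mim-value at most $\tau+50$. Moreover, for every cut $(A_e,B_e)$ induced by an edge $e\in E(P)$ and every semi-induced matching $M$ between $A_e$ and $B_e$, $M$ has at most $\tau$ matching edges and there exists $u\in V(H)$ such that $S(u)$ covers the matching edges of $M$ (each has an endpoint in $S(u)$).
   Context: Construction of $(G(H,\omega),\mathcal S(H,\omega))$: for each ordered pair $(u,v)$ with $uv\in E(H)$, add an independent set $I(u,v)$ of $\omega(uv)$ new vertices; let $S(u)=\bigcup_{v\in N_H(u)}I(u,v)$ and $\mathcal S=\{S(u):u\in V(H)\}$. Dummy edges: for every two edges $uv,xy$ of $H$ sharing no endpoint, every vertex of $I(u,v)$ is joined to every vertex of $I(x,y)$ (for all orientations). Matching edges: for every $uv\in E(H)$, a perfect matching between $I(u,v)$ and $I(v,u)$. These are all the edges of $G$. A total order on $V(H)$ is $\tau$-balancing if every vertex $v$ has $\sum_{u\in N(v),u\prec v}\omega(uv)\le\tau$ and $\sum_{u\in N(v),v\prec u}\omega(uv)\le\tau$. A path mapping of $(G,\mathcal S)$ is a pair $(P,f)$ with $P$ a path and $f:\mathcal S\to V(P)$ a bijection; each $e\in E(P)$ defines the cut $(A_e,B_e)$ of $V(G)$ given by the unions of parts mapped to the two components of $P-e$. A semi-induced matching between $A_e$ and $B_e$ is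 an induced matching of the bipartite graph formed by the edges of $G$ between $A_e$ and $B_e$; the mim-value of $(P,f)$ is the maximum over $e$ of the maximum size of such a matching. -}

module Defs where

open import Data.Bool using (Bool; true; false; T; if_then_else_; _∧_)
open import Data.Nat using (ℕ; zero; suc; _+_; _≤_; _<_; _<ᵇ_; _≤ᵇ_)
import Data.Nat as ℕ
open import Data.Fin using (Fin; toℕ)
import Data.Fin as Fin
open import Data.Fin.Permutation using (Permutation′; _⟨$⟩ʳ_)
open import Data.List using (List; length; lookup; tabulate; filter)
open import Data.Nat.ListAction using (sum)
open import Data.List.Relation.Unary.All using (All)
open import Data.Product using (Σ; ∃; ∃-syntax; _×_; _,_; proj₁; proj₂)
open import Data.Sum using (_⊎_)
open import Relation.Nullary using (¬_; Dec; yes; no)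
open import Relation.Nullary.Decidable using (_×-dec_)
open import Relation.Binary.PropositionalEquality using (_≡_; _≢_)

record WGraph : Set where
  field
    n      : ℕ
    adj    : Fin n → Fin n → Bool
    sym    : ∀ u v → adj u v ≡ adj v u
    irrefl : ∀ u → adj u u ≡ false
    ω      : Fin n → Fin n → ℕ
    ω-sym  : ∀ u v → T (adj u v) → ω u v ≡ ω v u
    ω-pos  : ∀ u v → T (adj u v) → 1 ≤ ω u v

module _ (H : WGraph) where
  open WGraph H

  ΣV : (Fin n → ℕ) → ℕ
  ΣV f = sum (tabulate f)

  -- A total order on V(H), given by its rank function σ (u ≺ v iff σ u < σ v).
  IsBalancing : ℕ → Permutation′ n → Set
  IsBalancing τ σ = ∀ v →
      ΣV (λ u → if adj u v ∧ (toℕ (σ ⟨$⟩ʳ u) <ᵇ toℕ (σ ⟨$⟩ʳ v)) then ω u v else 0) ≤ τ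
    × ΣV (λ u → if adj u v ∧ (toℕ (σ ⟨$⟩ʳ v) <ᵇ toℕ (σ ⟨$⟩ʳ u)) then ω u v else 0) ≤ τ

  HasBalancingOrder : ℕ → Set
  HasBalancingOrder τ = ∃[ σ ] IsBalancing τ σ

  -- The graph G(H, ω).  A vertex is (u, v, e, i) with uv ∈ E(H) and
  -- i ∈ Fin (ω u v): the i-th vertex of the independent set I(u,v).

  record GV : Set where
    constructor gv
    field
      src  : Fin n
      tgt  : Fin n
      edge : T (adj src tgt)
      idx  : Fin (ω src tgt)
  open GV public

  InS : Fin n → GV → Set
  InS u x = src x ≡ u

  -- dummy edges: I(u,v) complete to I(x,y) when uv and xy share no endpoint
  DummyEdge : GV → GV → Set
  DummyEdge a b = src a ≢ src b × src a ≢ tgt b × tgt a ≢ src b × tgt a ≢ tgt b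

  -- matching edges: the perfect matching I(u,v) ↔ I(v,u) pairing equal indices
  MatchEdge : GV → GV → Set
  MatchEdge a b = src a ≡ tgt b × tgt a ≡ src b × toℕ (idx a) ≡ toℕ (idx b)

  matchEdge? : ∀ a b → Dec (MatchEdge a b)
  matchEdge? a b = (src a Fin.≟ tgt b) ×-dec ((tgt a Fin.≟ src b) ×-dec (toℕ (idx a) ℕ.≟ toℕ (idx b)))

  GAdj : GV → GV → Set
  GAdj a b = DummyEdge a b ⊎ MatchEdge a b

  -- P is the path 0 - 1 - ... - (n-1); f : 𝒮 → V(P) is a
  -- bijection, represented as a permutation of Fin n sending u to the
  -- position of S(u).  The edge e_k = {k, k+1} (k + 1 < n) of P induces the
  -- cut (A_k, B_k) with A_k = ⋃ {S(u) | f(u) ≤ k}.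

  InA : Permutation′ n → ℕ → GV → Set
  InA f k x = toℕ (f ⟨$⟩ʳ src x) ≤ k

  record SemiInduced (f : Permutation′ n) (k : ℕ) (M : List (GV × GV)) : Set where
    field
      crossing : All (λ p → InA f k (proj₁ p) × ¬ InA f k (proj₂ p) × GAdj (proj₁ p) (proj₂ p)) M
      disjointA : ∀ i j → i ≢ j → proj₁ (lookup M i) ≢ proj₁ (lookup M j)
      disjointB : ∀ i j → i ≢ j → proj₂ (lookup M i) ≢ proj₂ (lookup M j)
      induced  : ∀ i j → i ≢ j → ¬ GAdj (proj₁ (lookup M i)) (proj₂ (lookup M j))

  matchingEdgesOf : List (GV × GV) → List (GV × GV)
  matchingEdgesOf = filter (λ p → matchEdge? (proj₁ p) (proj₂ p))

{-# OPTIONS --safe #-}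
-- Take the path order to be the balancing order σ and cut it after the first k + 1 parts. In a
-- semi-induced matching M across the cut, any two edges x y and x′ y′ have x and y′ non-adjacent, so
-- the H-edges spanned by x and by y′ share a vertex (otherwise G has a dummy edge x y′). For the dummy
-- edges of M this makes the pairs of H-edges of their ends a Bollobás set-pair system of 2-sets, which
-- has bounded size. For the matching edges it forces any two of them to share their A-side vertex of H
-- or their B-side vertex, hence all of them run through one part S(c). Their endpoints in S(c) are
-- distinct and lie in blocks I(c , w) with all w on one side of c in σ, so there are at most τ of them.
module Submission where

open import Level using (Level; 0ℓ)
open import Data.Bool using (Bool; T; if_then_else_; _∧_)
open import Data.Bool.Properties using (T-≡; T-∧; T-irrelevant; if-cong)
open import Data.Empty using (⊥-elim)
open import Data.Fin using (Fin; toℕ; fromℕ<)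
import Data.Fin as Fin
open import Data.Fin.Permutation using (Permutation′; _⟨$⟩ʳ_)
open import Data.Fin.Properties using (toℕ<n; toℕ-injective)
open import Data.List using (List; []; _∷_; length; map; concat; tabulate; upTo; filter; lookup)
open import Data.List.Properties
  using (length-++; length-map; length-upTo; map-tabulate; tabulate-cong; tabulate-lookup; filter-notAll)
open import Data.List.Membership.Propositional using (_∈_)
open import Data.List.Membership.Propositional.Properties
  using (∈-filter⁺; ∈-concat⁺′; ∈-map⁺; ∈-upTo⁺; ∈-tabulate⁺)
open import Data.List.Relation.Unary.All as All using (All; []; _∷_)
import Data.List.Relation.Unary.All.Properties as All
open import Data.List.Relation.Unary.AllPairs as AllPairs using (AllPairs; []; _∷_)
import Data.List.Relation.Unary.AllPairs.Properties as AllPairs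
open import Data.List.Relation.Unary.Any as Any using (Any; here; there)
open import Data.List.Relation.Unary.Unique.Propositional using (Unique)
open import Data.Nat using (ℕ; suc; _+_; _*_; _≤_; _<_; _<ᵇ_; z≤n; s≤s)
import Data.Nat as ℕ
open import Data.Nat.ListAction using (sum)
open import Data.Nat.Properties
  using (≤-trans; +-mono-≤; +-suc; m≤m+n; <⇒<ᵇ; ≤-<-trans; ≰⇒>; module ≤-Reasoning)
open import Data.Product using (∃-syntax; _×_; _,_; proj₁; proj₂)
import Data.Product.Properties as Product
open import Data.Sum using (_⊎_; inj₁; inj₂)
open import Function using (_∘_; Equivalence)
open import Relation.Binary using (Rel; DecidableEquality)
open import Relation.Binary.PropositionalEquality
  using (_≡_; _≢_; refl; sym; trans; cong; cong₂; subst; subst₂; module ≡-Reasoning)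
open import Relation.Nullary using (¬_; Dec; yes; no; ¬?)
open import Relation.Nullary.Decidable using (_⊎-dec_; decidable-stable)
open import Relation.Unary using (Pred; Decidable)
open import Relation.Unary.Properties using (∁?)

open import Defs

private
  variable
    a b p q r : Level
    A : Set a

module _ {P : Pred A p} (P? : Decidable P) where

  length-filter-split : ∀ xs → length xs ≡ length (filter P? xs) + length (filter (∁? P?) xs)
  length-filter-split []       = refl
  length-filter-split (x ∷ xs) with P? x
  ... | yes _ = cong suc (length-filter-split xs)
  ... | no  _ = trans (cong suc (length-filter-split xs)) (sym (+-suc _ _))

  All-filter⁺-× : ∀ {Q : Pred A q} {xs} → All Q xs → All (λ x → Q x × P x) (filter P? xs)
  All-filter⁺-× {xs = xs} qs = All.zip (All.filter⁺ P? qs , All.all-filter P? xs)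

  All-filter⇒guarded : ∀ {Q : Pred A q} xs → All Q (filter P? xs) → All (λ x → P x → Q x) xs
  All-filter⇒guarded xs qs = All.filter⁻ P? (All.map (λ qx _ → qx) qs)
    (All.map (λ ¬px px → ⊥-elim (¬px px)) (All.all-filter (∁? P?) xs))

AllPairs-lookup : ∀ {R : Rel A r} xs → (∀ {i j} → i ≢ j → R (lookup xs i) (lookup xs j)) → AllPairs R xs
AllPairs-lookup {R = R} xs R-lookup = subst (AllPairs R) (tabulate-lookup xs) (AllPairs.tabulate⁺ R-lookup)

AllPairs-zipWithAll : ∀ {P : Pred A p} {R : Rel A q} {S : Rel A r} →
  (∀ {x y} → P x → P y → R x y → S x y) → ∀ {xs} → All P xs → AllPairs R xs → AllPairs S xs
AllPairs-zipWithAll f []         []         = []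
AllPairs-zipWithAll f (px ∷ pxs) (rx ∷ rxs) =
  All.zipWith (λ (py , rxy) → f px py rxy) (pxs , rx) ∷ AllPairs-zipWithAll f pxs rxs

module _ (_≟_ : DecidableEquality A) where

  Unique-⊆⇒length≤ : ∀ {xs ys} → Unique xs → All (_∈ ys) xs → length xs ≤ length ys
  Unique-⊆⇒length≤ {xs = []}     _              _             = z≤n
  Unique-⊆⇒length≤ {xs = x ∷ xs} {ys} (x∉xs ∷ xs!) (x∈ys ∷ xs⊆ys) = ≤-trans
    (s≤s (Unique-⊆⇒length≤ xs! (All.zipWith (λ (x≢y , y∈ys) → ∈-filter⁺ ≢x? y∈ys x≢y)
                                             (x∉xs , xs⊆ys))))
    (filter-notAll ≢x? ys (Any.map (λ x≡y x≢y → x≢y x≡y) x∈ys))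
    where
      ≢x? : Decidable (x ≢_)
      ≢x? y = ¬? (x ≟ y)

length-concat : ∀ (xss : List (List A)) → length (concat xss) ≡ sum (map length xss)
length-concat []         = refl
length-concat (xs ∷ xss) = trans (length-++ xs) (cong (length xs +_) (length-concat xss))

slots : ∀ {n} → (Fin n → ℕ) → List (Fin n × ℕ)
slots m = concat (tabulate (λ w → map (w ,_) (upTo (m w))))

length-slots : ∀ {n} (m : Fin n → ℕ) → length (slots m) ≡ sum (tabulate m)
length-slots {n} m = begin
  length (slots m)                         ≡⟨ length-concat (tabulate block) ⟩
  sum (map length (tabulate block))        ≡⟨ cong sum (map-tabulate block length) ⟩
  sum (tabulate (length ∘ block))          ≡⟨ cong sum (tabulate-cong length-block) ⟩
  sum (tabulate m)                         ∎
  where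
    open ≡-Reasoning
    block : Fin n → List (Fin n × ℕ)
    block w = map (w ,_) (upTo (m w))
    length-block : ∀ w → length (block w) ≡ m w
    length-block w = trans (length-map (w ,_) (upTo (m w))) (length-upTo (m w))

∈-slots : ∀ {n} (m : Fin n → ℕ) {w i} → i < m w → (w , i) ∈ slots m
∈-slots m {w} i<m = ∈-concat⁺′ (∈-map⁺ (w ,_) (∈-upTo⁺ i<m)) (∈-tabulate⁺ w)

module _ {B : Set b} (u v : A → B) where

  Agree : Rel A b
  Agree x y = u x ≡ u y ⊎ v x ≡ v y

  AllPairs-Agree⇒constant : DecidableEquality B → ∀ {x xs} → AllPairs Agree (x ∷ xs) →
    ∃[ c ] (All (λ y → u y ≡ c) (x ∷ xs) ⊎ All (λ y → v y ≡ c) (x ∷ xs))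
  AllPairs-Agree⇒constant _≟_ {x} {[]}    _            = u x , inj₁ (refl ∷ [])
  AllPairs-Agree⇒constant _≟_ {x} {_ ∷ _} (x~xs ∷ xs~) with AllPairs-Agree⇒constant _≟_ xs~
  ... | c , inj₁ us with u x ≟ c
  ...   | yes ux≡c = c , inj₁ (ux≡c ∷ us)
  ...   | no  ux≢c = v x , inj₂ (refl ∷ All.zipWith vs (x~xs , us))
    where
      vs : ∀ {y} → Agree x y × u y ≡ c → v y ≡ v x
      vs (inj₁ ux≡uy , uy≡c) = ⊥-elim (ux≢c (trans ux≡uy uy≡c))
      vs (inj₂ vx≡vy , _)    = sym vx≡vy
  AllPairs-Agree⇒constant _≟_ {x} {_ ∷ _} (x~xs ∷ xs~) | c , inj₂ vs with v x ≟ c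
  ...   | yes vx≡c = c , inj₂ (vx≡c ∷ vs)
  ...   | no  vx≢c = u x , inj₁ (refl ∷ All.zipWith us (x~xs , vs))
    where
      us : ∀ {y} → Agree x y × v y ≡ c → u y ≡ u x
      us (inj₂ vx≡vy , vy≡c) = ⊥-elim (vx≢c (trans vx≡vy vy≡c))
      us (inj₁ ux≡uy , _)    = sym ux≡uy

-- Bollobás set-pair systems of 2-sets; Bollobás's theorem gives the sharp bound 6 on their size, 9 suffices here.
module SetPairSystem {V : Set a} (_≟_ : DecidableEquality V) where

  _∈₂_ : V → V × V → Set a
  z ∈₂ (x , y) = z ≡ x ⊎ z ≡ y

  _∈₂?_ : ∀ z e → Dec (z ∈₂ e)
  z ∈₂? (x , y) = (z ≟ x) ⊎-dec (z ≟ y)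

  Meets : Rel (V × V) a
  Meets e f = ∃[ z ] z ∈₂ e × z ∈₂ f

  meets? : ∀ e f → Dec (Meets e f)
  meets? (x , y) f with x ∈₂? f | y ∈₂? f
  ... | yes x∈f | _       = yes (x , inj₁ refl , x∈f)
  ... | no  _   | yes y∈f = yes (y , inj₂ refl , y∈f)
  ... | no  x∉f | no  y∉f = no λ { (_ , inj₁ refl , z∈f) → x∉f z∈f
                                 ; (_ , inj₂ refl , z∈f) → y∉f z∈f }

  ∈₂-other : ∀ {X z w e} → X ∈₂ e → z ∈₂ e → w ∈₂ e → z ≢ X → w ≢ X → z ≡ w
  ∈₂-other _          (inj₁ refl) (inj₁ refl) _   _   = refl
  ∈₂-other _          (inj₂ refl) (inj₂ refl) _   _   = refl
  ∈₂-other (inj₁ refl) (inj₁ refl) (inj₂ _)   z≢X _   = ⊥-elim (z≢X refl)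
  ∈₂-other (inj₂ refl) (inj₁ _)   (inj₂ refl) _   w≢X = ⊥-elim (w≢X refl)
  ∈₂-other (inj₁ refl) (inj₂ _)   (inj₁ refl) _   w≢X = ⊥-elim (w≢X refl)
  ∈₂-other (inj₂ refl) (inj₂ refl) (inj₁ _)   z≢X _   = ⊥-elim (z≢X refl)

  SetPair : Set a
  SetPair = (V × V) × (V × V)

  Disjoint : SetPair → Set a
  Disjoint (e , f) = ¬ Meets e f

  CrossMeet : Rel SetPair a
  CrossMeet (e , f) (e′ , f′) = Meets e f′ × Meets e′ f

  Pinned : V × V → SetPair → Set a
  Pinned (X , S) (e , f) = X ∈₂ e × S ∈₂ f

  pinned? : ∀ c → Decidable (Pinned c)
  pinned? (X , S) (e , f) with X ∈₂? e | S ∈₂? f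
  ... | yes X∈e | yes S∈f = yes (X∈e , S∈f)
  ... | no  X∉e | _       = no (X∉e ∘ proj₁)
  ... | _       | no  S∉f = no (S∉f ∘ proj₂)

  meet-avoids-pins : ∀ {c s t z} → Disjoint s → Disjoint t → Pinned c s → Pinned c t →
    z ∈₂ proj₁ s → z ∈₂ proj₂ t → z ≢ proj₁ c × z ≢ proj₂ c
  meet-avoids-pins s∅ t∅ (_ , S∈f) (X∈e′ , _) z∈e z∈f′ =
    (λ { refl → t∅ (_ , X∈e′ , z∈f′) }) , (λ { refl → s∅ (_ , z∈e , S∈f) })

  -- A meet point of e and f′ is the unpinned element of both, so the meet points of eₛ ∩ fₜ, eₛ ∩ fᵣ
  -- and eᵣ ∩ fₜ coincide and lie in eᵣ ∩ fᵣ.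
  pinned-length≤2 : ∀ {c} xs → All Disjoint xs → All (Pinned c) xs → AllPairs CrossMeet xs →
    length xs ≤ 2
  pinned-length≤2 []             _ _ _ = z≤n
  pinned-length≤2 (_ ∷ [])       _ _ _ = s≤s z≤n
  pinned-length≤2 (_ ∷ _ ∷ [])   _ _ _ = s≤s (s≤s z≤n)
  pinned-length≤2 {c} (s ∷ t ∷ r ∷ _) (s∅ ∷ t∅ ∷ r∅ ∷ _) (s⊙ ∷ t⊙ ∷ r⊙ ∷ _)
    ( (((z , z∈eₛ , z∈fₜ) , _) ∷ ((z′ , z′∈eₛ , z′∈fᵣ) , _) ∷ _)
    ∷ ((_ , (z″ , z″∈eᵣ , z″∈fₜ)) ∷ _) ∷ _) =
    ⊥-elim (r∅ (z″ , z″∈eᵣ , subst (_∈₂ proj₂ r) (trans (sym z≡z′) z≡z″) z′∈fᵣ))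
    where
      z-avoids : z ≢ proj₁ c × z ≢ proj₂ c
      z-avoids = meet-avoids-pins s∅ t∅ s⊙ t⊙ z∈eₛ z∈fₜ
      z≡z′ : z ≡ z′
      z≡z′ = ∈₂-other (proj₁ s⊙) z∈eₛ z′∈eₛ (proj₁ z-avoids)
        (proj₁ (meet-avoids-pins s∅ r∅ s⊙ r⊙ z′∈eₛ z′∈fᵣ))
      z≡z″ : z ≡ z″
      z≡z″ = ∈₂-other (proj₂ t⊙) z∈fₜ z″∈fₜ (proj₂ z-avoids)
        (proj₂ (meet-avoids-pins r∅ t∅ r⊙ t⊙ z″∈eᵣ z″∈fₜ))

  pinned-somewhere-length≤ : ∀ cs xs → All Disjoint xs → AllPairs CrossMeet xs →
    All (λ s → Any (λ c → Pinned c s) cs) xs → length xs ≤ length cs * 2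
  pinned-somewhere-length≤ []       []      _  _  _      = z≤n
  pinned-somewhere-length≤ []       (_ ∷ _) _  _  (() ∷ _)
  pinned-somewhere-length≤ (c ∷ cs) xs      ds ms pinned = begin
    length xs                                                      ≡⟨ length-filter-split (pinned? c) xs ⟩
    length (filter (pinned? c) xs) + length (filter unpinned? xs)  ≤⟨ +-mono-≤ at-c elsewhere ⟩
    2 + length cs * 2                                              ∎
    where
      open ≤-Reasoning
      unpinned? : Decidable (¬_ ∘ Pinned c)
      unpinned? = ∁? (pinned? c)
      at-c : length (filter (pinned? c) xs) ≤ 2
      at-c = pinned-length≤2 (filter (pinned? c) xs) (All.filter⁺ (pinned? c) ds)
        (All.all-filter (pinned? c) xs) (AllPairs.filter⁺ (pinned? c) ms)
      elsewhere : length (filter unpinned? xs) ≤ length cs * 2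
      elsewhere = pinned-somewhere-length≤ cs (filter unpinned? xs) (All.filter⁺ unpinned? ds)
        (AllPairs.filter⁺ unpinned? ms)
        (All.zipWith (λ (¬c , somewhere) → Any.tail ¬c somewhere)
          (All.all-filter unpinned? xs , All.filter⁺ unpinned? pinned))

  corners : SetPair → List (V × V)
  corners ((x , y) , (x′ , y′)) = (x′ , x) ∷ (x′ , y) ∷ (y′ , x) ∷ (y′ , y) ∷ []

  crossMeet⇒pinned-at-corner : ∀ {s t} → CrossMeet s t → Any (λ c → Pinned c t) (corners s)
  crossMeet⇒pinned-at-corner ((S , S∈e , S∈f′) , (X , X∈e′ , X∈f)) with X∈f | S∈e
  ... | inj₁ refl | inj₁ refl = here (X∈e′ , S∈f′)
  ... | inj₁ refl | inj₂ refl = there (here (X∈e′ , S∈f′))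
  ... | inj₂ refl | inj₁ refl = there (there (here (X∈e′ , S∈f′)))
  ... | inj₂ refl | inj₂ refl = there (there (there (here (X∈e′ , S∈f′))))

  length≤9 : ∀ xs → All Disjoint xs → AllPairs CrossMeet xs → length xs ≤ 9
  length≤9 []       _        _           = z≤n
  length≤9 (s ∷ xs) (_ ∷ ds) (s~xs ∷ ms) =
    s≤s (pinned-somewhere-length≤ (corners s) xs ds ms (All.map crossMeet⇒pinned-at-corner s~xs))

module _ (H : WGraph) where
  open WGraph H renaming (sym to adj-sym)
  open SetPairSystem (Fin._≟_ {n})

  gv-≡ : ∀ {x y : GV H} → src x ≡ src y → tgt x ≡ tgt y → toℕ (idx x) ≡ toℕ (idx y) → x ≡ y
  gv-≡ {gv s t e i} {gv .s .t e′ i′} refl refl i≡i′ =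
    cong₂ (gv s t) (T-irrelevant e e′) (toℕ-injective i≡i′)

  ends : GV H → Fin n × Fin n
  ends x = src x , tgt x

  dummyEdge⇒disjoint : ∀ {x y} → DummyEdge H x y → ¬ Meets (ends x) (ends y)
  dummyEdge⇒disjoint (d₁ , _  , _  , _ ) (_ , inj₁ refl , inj₁ refl) = d₁ refl
  dummyEdge⇒disjoint (_  , d₂ , _  , _ ) (_ , inj₁ refl , inj₂ refl) = d₂ refl
  dummyEdge⇒disjoint (_  , _  , d₃ , _ ) (_ , inj₂ refl , inj₁ refl) = d₃ refl
  dummyEdge⇒disjoint (_  , _  , _  , d₄) (_ , inj₂ refl , inj₂ refl) = d₄ refl

  ¬adjacent⇒meets : ∀ {x y} → ¬ GAdj H x y → Meets (ends x) (ends y)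
  ¬adjacent⇒meets ¬adj = decidable-stable (meets? _ _) λ ¬meets → ¬adj (inj₁
    ( (λ e → ¬meets (_ , inj₁ refl , inj₁ e)) , (λ e → ¬meets (_ , inj₁ refl , inj₂ e))
    , (λ e → ¬meets (_ , inj₂ refl , inj₁ e)) , (λ e → ¬meets (_ , inj₂ refl , inj₂ e)) ))

  weightTowards : Fin n → (Fin n → Bool) → Fin n → ℕ
  weightTowards c side w = if adj w c ∧ side w then ω w c else 0

  slot : GV H → Fin n × ℕ
  slot x = tgt x , toℕ (idx x)

  slot∈ : ∀ {c side} x → src x ≡ c → T (side (tgt x)) → slot x ∈ slots (weightTowards c side)
  slot∈ {side = side} (gv c w e i) refl side-w =
    ∈-slots (weightTowards c side) (subst (toℕ i <_) ω≡weight (toℕ<n i))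
    where
      ω≡weight : ω c w ≡ weightTowards c side w
      ω≡weight = trans (ω-sym c w e)
        (sym (if-cong (Equivalence.to T-≡ (Equivalence.from T-∧ (subst T (adj-sym c w) e , side-w)))))

  Unique-S-length≤ : ∀ c side xs → Unique xs → All (λ x → src x ≡ c × T (side (tgt x))) xs →
    length xs ≤ ΣV H (weightTowards c side)
  Unique-S-length≤ c side xs xs! inS = begin
    length xs                             ≡⟨ length-map slot xs ⟨
    length (map slot xs)                  ≤⟨ Unique-⊆⇒length≤ ≟-slot slots-unique slots-⊆ ⟩
    length (slots (weightTowards c side)) ≡⟨ length-slots (weightTowards c side) ⟩
    ΣV H (weightTowards c side)           ∎
    where
      open ≤-Reasoning
      ≟-slot : DecidableEquality (Fin n × ℕ)
      ≟-slot = Product.≡-dec Fin._≟_ ℕ._≟_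
      slot-injective : ∀ {x y} → src x ≡ c → src y ≡ c → x ≢ y → slot x ≢ slot y
      slot-injective sx≡c sy≡c x≢y slots≡ =
        x≢y (gv-≡ (trans sx≡c (sym sy≡c)) (cong proj₁ slots≡) (cong proj₂ slots≡))
      slots-unique : Unique (map slot xs)
      slots-unique = AllPairs.map⁺ (AllPairs-zipWithAll slot-injective (All.map proj₁ inS) xs!)
      slots-⊆ : All (_∈ slots (weightTowards c side)) (map slot xs)
      slots-⊆ = All.map⁺ (All.map (λ {x} (sx≡c , side-x) → slot∈ x sx≡c side-x) inS)

module Cut (H : WGraph) (σ : Permutation′ (WGraph.n H)) (k : ℕ) where
  open WGraph H using (n)
  open SetPairSystem (Fin._≟_ {n})

  pos : Fin n → ℕ
  pos u = toℕ (σ ⟨$⟩ʳ u)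

  GPair : Set
  GPair = GV H × GV H

  Crossing : GPair → Set
  Crossing (x , y) = InA H σ k x × ¬ InA H σ k y × GAdj H x y

  Matching : GPair → Set
  Matching (x , y) = MatchEdge H x y

  matching? : Decidable Matching
  matching? (x , y) = matchEdge? H x y

  Separated : Rel GPair 0ℓ
  Separated (x , y) (x′ , y′) = x ≢ x′ × y ≢ y′ × ¬ GAdj H x y′

  Independent : Rel GPair 0ℓ
  Independent s t = Separated s t × Separated t s

  semiInduced⇒independent : ∀ {M} → SemiInduced H σ k M → AllPairs Independent M
  semiInduced⇒independent {M} si = AllPairs-lookup M (λ i≢j → separated i≢j , separated (i≢j ∘ sym))
    where
      open SemiInduced si
      separated : ∀ {i j} → i ≢ j → Separated (lookup M i) (lookup M j)
      separated i≢j = disjointA _ _ i≢j , disjointB _ _ i≢j , induced _ _ i≢j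

  cut-separates : ∀ {u w} → pos u ≤ k → ¬ pos w ≤ k → u ≢ w
  cut-separates u≤k w≰k refl = w≰k u≤k

  crossing-forward : ∀ {s} → Crossing s → pos (src (proj₁ s)) < pos (src (proj₂ s))
  crossing-forward (x∈A , y∉A , _) = ≤-<-trans x∈A (≰⇒> y∉A)

  CrossingMatching : GPair → Set
  CrossingMatching s = Crossing s × Matching s

  srcᴬ srcᴮ : GPair → Fin n
  srcᴬ = src ∘ proj₁
  srcᴮ = src ∘ proj₂

  crossingMatchings-agree : ∀ {s t} → CrossingMatching s → CrossingMatching t → Independent s t →
    Agree srcᴬ srcᴮ s t
  crossingMatchings-agree {x , y} {x′ , y′} ((x∈A , y∉A , _) , sx≡ty , tx≡sy , _)
    ((x′∈A , y′∉A , _) , sx′≡ty′ , _) ((_ , _ , ¬adj) , _)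
    with src x Fin.≟ src x′ | src y Fin.≟ src y′
  ... | yes sx≡sx′ | _          = inj₁ sx≡sx′
  ... | no  _      | yes sy≡sy′ = inj₂ sy≡sy′
  ... | no  sx≢sx′ | no  sy≢sy′ = ⊥-elim (¬adj (inj₁
    ( cut-separates x∈A y′∉A
    , (λ e → sx≢sx′ (trans e (sym sx′≡ty′)))
    , (λ e → sy≢sy′ (trans (sym tx≡sy) e))
    , (λ e → cut-separates x′∈A y∉A (trans sx′≡ty′ (trans (sym e) tx≡sy))) )))

  endpoints-length≤ : ∀ (end : GPair → GV H) c side L → AllPairs (λ s t → end s ≢ end t) L →
    All (λ s → src (end s) ≡ c × T (side (tgt (end s)))) L → length L ≤ ΣV H (weightTowards H c side)
  endpoints-length≤ end c side L distinct inS =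
    subst (_≤ ΣV H (weightTowards H c side)) (length-map end L)
      (Unique-S-length≤ H c side (map end L) (AllPairs.map⁺ distinct) (All.map⁺ inS))

  module _ {τ} (balanced : IsBalancing H τ σ) where

    sameSrcᴬ-length≤ : ∀ c L → All CrossingMatching L → AllPairs Independent L →
      All (λ s → srcᴬ s ≡ c) L → length L ≤ τ
    sameSrcᴬ-length≤ c L cms ind at-c = ≤-trans
      (endpoints-length≤ proj₁ c (λ w → pos c <ᵇ pos w) L
        (AllPairs.map (λ {s} {t} → proj₁ ∘ proj₁) ind)
        (All.zipWith (λ {s} ((cross , _ , tx≡sy , _) , sx≡c) → sx≡c ,
          <⇒<ᵇ (subst₂ (λ u w → pos u < pos w) sx≡c (sym tx≡sy) (crossing-forward {s} cross)))
          (cms , at-c)))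
      (proj₂ (balanced c))

    sameSrcᴮ-length≤ : ∀ c L → All CrossingMatching L → AllPairs Independent L →
      All (λ s → srcᴮ s ≡ c) L → length L ≤ τ
    sameSrcᴮ-length≤ c L cms ind at-c = ≤-trans
      (endpoints-length≤ proj₂ c (λ w → pos w <ᵇ pos c) L
        (AllPairs.map (λ {s} {t} → proj₁ ∘ proj₂ ∘ proj₁) ind)
        (All.zipWith (λ {s} ((cross , sx≡ty , _) , sy≡c) → sy≡c ,
          <⇒<ᵇ (subst₂ (λ u w → pos u < pos w) sx≡ty sy≡c (crossing-forward {s} cross)))
          (cms , at-c)))
      (proj₁ (balanced c))

    Covers : Fin n → GPair → Set
    Covers c (x , y) = InS H c x ⊎ InS H c y

    crossingMatchings-length≤-covered : Fin n → ∀ L → All CrossingMatching L → AllPairs Independent L →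
      length L ≤ τ × ∃[ c ] All (Covers c) L
    crossingMatchings-length≤-covered c₀ [] _ _ = z≤n , c₀ , []
    crossingMatchings-length≤-covered _ L@(_ ∷ _) cms ind
      with AllPairs-Agree⇒constant srcᴬ srcᴮ Fin._≟_
             (AllPairs-zipWithAll (λ {s} {t} → crossingMatchings-agree {s} {t}) cms ind)
    ... | c , inj₁ at-c = sameSrcᴬ-length≤ c L cms ind at-c , c , All.map inj₁ at-c
    ... | c , inj₂ at-c = sameSrcᴮ-length≤ c L cms ind at-c , c , All.map inj₂ at-c

  endsPair : GPair → SetPair
  endsPair (x , y) = ends H x , ends H y

  crossingDummies-length≤9 : ∀ L → All (λ s → Crossing s × ¬ Matching s) L → AllPairs Independent L →
    length L ≤ 9
  crossingDummies-length≤9 L cds ind = subst (_≤ 9) (length-map endsPair L)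
    (length≤9 (map endsPair L) (All.map⁺ (All.map (λ {s} → disjoint {s}) cds))
      (AllPairs.map⁺ (AllPairs.map (λ {s} {t} → crossMeet {s} {t}) ind)))
    where
      disjoint : ∀ {s} → Crossing s × ¬ Matching s → Disjoint (endsPair s)
      disjoint {x , y} ((_ , _ , inj₁ dummy) , _)      = dummyEdge⇒disjoint H {x} {y} dummy
      disjoint         ((_ , _ , inj₂ match) , ¬match) = ⊥-elim (¬match match)
      crossMeet : ∀ {s t} → Independent s t → CrossMeet (endsPair s) (endsPair t)
      crossMeet {x , y} {x′ , y′} ((_ , _ , ¬adj) , (_ , _ , ¬adj′)) =
        ¬adjacent⇒meets H {x} {y′} ¬adj , ¬adjacent⇒meets H {x′} {y} ¬adj′

lemma23 : (H : WGraph) (τ : ℕ) → HasBalancingOrder H τ →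
    ∃[ f ] (∀ (k : ℕ) → suc k < WGraph.n H → (M : List (GV H × GV H)) → SemiInduced H f k M →
      length M ≤ τ + 50
      × length (matchingEdgesOf H M) ≤ τ
      × ∃[ u ] All (λ p → MatchEdge H (proj₁ p) (proj₂ p) → InS H u (proj₁ p) ⊎ InS H u (proj₂ p)) M)
lemma23 H τ (σ , balanced) = σ , λ k k+1<n M si →
  let open Cut H σ k
      independent = semiInduced⇒independent si
      crossing = SemiInduced.crossing si
      dummy? = ∁? matching?
      some-vertex = fromℕ< (≤-trans (s≤s z≤n) k+1<n)
      (matchings≤τ , c , covered) = crossingMatchings-length≤-covered balanced some-vertex (filter matching? M)
        (All-filter⁺-× matching? crossing) (AllPairs.filter⁺ matching? independent)
      dummies≤9 = crossingDummies-length≤9 (filter dummy? M)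
        (All-filter⁺-× dummy? crossing) (AllPairs.filter⁺ dummy? independent)
  in subst (_≤ τ + 50) (sym (length-filter-split matching? M))
       (+-mono-≤ matchings≤τ (≤-trans dummies≤9 (m≤m+n 9 41)))
     , matchings≤τ
     , c , All-filter⇒guarded matching? M covered
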